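{- For any integers $k \geq 2$, $\alpha,\beta \geq 0$ and $0 \leq m \leq \min(\alpha,\beta)$, $${_m}C_{k,(\alpha,\beta)}(t) = C_{k,(\alpha-m,0)}(t) \, C_k(t)^{\beta-m}.$$
   Context: For an integer $k\ge 2$ and integers $\alpha,\beta, n\ge 0$, let $\mathcal{D}^k_{n,(\alpha,\beta)}$ be the set of integer lattice paths from $(0,\alpha)$ to $(kn+\beta-\alpha,\beta)$ using steps $U=(1,1)$ and $D=(1,1-k)$ that stay weakly above the line $y=0$ (such paths have exactly $n$ steps $D$; the empty path is included when $n=0$, $\alpha=\beta$), with $C^k_{n,(\alpha,\beta)}=|\mathcal{D}^k_{n,(\alpha,\beta)}|$ and $C_{k,(\alpha,\beta)}(t)=\sum_{n\ge0}C^k_{n,(\alpha,\beta)}t^n$. For $m\ge 0$, ${_m}C^k_{n,(\alpha,\beta)}$ is the number of paths in $\mathcal{D}^k_{n,(\alpha,\beta)}$ whose minimum $y$-coordinate equals $m$, and ${_m}C_{k,(\alpha,\beta)}(t)=\sum_{n\ge0}{_m}C^k_{n,(\alpha,\beta)}t^n$. $C_k(t)=\sum_{n\ge0} \frac{1}{kn+1}\binom{kn+1}{n} t^n$ is the $k$-Catalan generating function. -}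

module Defs where

open import Data.Nat as ℕ using (ℕ; zero; suc; _∸_)
open import Data.Nat.Combinatorics using (_C_)
open import Data.Nat.DivMod using (_/_)
open import Data.Integer as ℤ using (ℤ; +_; _⊓_)
open import Data.List using (List; []; _∷_; [_]; length; concatMap; filterᵇ)
open import Data.Bool using (Bool; _∧_)
open import Relation.Nullary.Decidable using (⌊_⌋)

-- Steps U = (1,1) and D = (1,1-k)
data Step : Set where
  U D : Step

δ : ℕ → Step → ℤ
δ k U = + 1
δ k D = + 1 ℤ.- + k

endY : ℕ → ℤ → List Step → ℤ
endY k h []       = h
endY k h (s ∷ p) = endY k (h ℤ.+ δ k s) p

minY : ℕ → ℤ → List Step → ℤ
minY k h []       = h
minY k h (s ∷ p) = h ⊓ minY k (h ℤ.+ δ k s) p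

countD : List Step → ℕ
countD []       = 0
countD (U ∷ p) = countD p
countD (D ∷ p) = suc (countD p)

allPaths : ℕ → List (List Step)
allPaths zero    = [ [] ]
allPaths (suc L) = concatMap (λ p → (U ∷ p) ∷ (D ∷ p) ∷ []) (allPaths L)

inDᵇ : (k n α β : ℕ) → List Step → Bool
inDᵇ k n α β p =
  ⌊ (+ length p) ℤ.≟ ((+ (k ℕ.* n)) ℤ.+ + β) ℤ.- + α ⌋ ∧
  (⌊ countD p ℕ.≟ n ⌋ ∧
  (⌊ endY k (+ α) p ℤ.≟ + β ⌋ ∧
   ⌊ + 0 ℤ.≤? minY k (+ α) p ⌋))

-- any path in 𝒟^k_{n,(α,β)} has length (kn+β) ∸ α, so enumerating
-- all step sequences of that length is exhaustive
candidates : (k n α β : ℕ) → List (List Step)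
candidates k n α β = allPaths ((k ℕ.* n ℕ.+ β) ∸ α)

Cnum : (k α β n : ℕ) → ℕ
Cnum k α β n = length (filterᵇ (inDᵇ k n α β) (candidates k n α β))

mCnum : (k α β m n : ℕ) → ℕ
mCnum k α β m n =
  length (filterᵇ (λ p → inDᵇ k n α β p ∧ ⌊ minY k (+ α) p ℤ.≟ + m ⌋)
                  (candidates k n α β))

Series : Set
Series = ℕ → ℕ

sumTo : ℕ → (ℕ → ℕ) → ℕ
sumTo zero    f = f 0
sumTo (suc n) f = sumTo n f ℕ.+ f (suc n)

_⋆_ : Series → Series → Series
(f ⋆ g) n = sumTo n (λ i → f i ℕ.* g (n ∸ i))

oneS : Series
oneS zero    = 1
oneS (suc _) = 0

_^S_ : Series → ℕ → Series
f ^S zero  = oneS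
f ^S suc e = f ⋆ (f ^S e)

-- k-Catalan generating function: coefficients (1/(kn+1)) binom(kn+1, n)
-- (exact division; the quotient is an integer)
Ck : ℕ → Series
Ck k n = ((k ℕ.* n ℕ.+ 1) C n) / suc (k ℕ.* n)

CGF : (k α β : ℕ) → Series
CGF k α β = Cnum k α β

mCGF : (k α β m : ℕ) → Series
mCGF k α β m = mCnum k α β m

-- Lowering a path by its minimum m identifies the paths counted by _mC_{(α,β)} with the paths
-- from α − m to β − m that touch height 0, so only m = 0 matters.  Splitting a path at its last
-- visit to 0 gives
--   C_{(a,b+1)} = C_{(a,0)} · C_{(0,b)} + C_{(a−1,b)}      (C_{(−1,b)} = 0),
-- where the last term counts the paths that never touch 0 (lifts of paths from a − 1 to b); this
-- is proved by induction on the length through the first-step recursion.  Hence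
-- _0C_{(a,b+1)} = C_{(a,0)} · C_{(0,b)}, and at a = 0 the identity gives C_{(0,b)} = C_{(0,0)}^{b+1}.
-- Finally C_{(0,0)} = C_k: the last-step recursion from height 0 gives the ballot formula
--   C^k_{n,(0,b)} = binom(kn+b, n) − (k−1)·binom(kn+b, n−1),
-- which for b = 0 equals binom(kn+1, n)/(kn+1).
module Submission where

open import Defs
open import Data.Bool using (Bool; true; false; _∧_; T; if_then_else_; T?)
open import Data.Bool.Properties using (T-∧)
open import Data.List using (List; []; _∷_; length; filterᵇ; concat; map)
open import Data.List.Relation.Unary.All as All using (All; []; _∷_)
open import Data.List.Relation.Unary.All.Properties using (concat⁺; gmap⁺)
open import Data.Integer as ℤ using (ℤ; +_; -[1+_]; _⊓_; _⊖_; +≤+)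
import Data.Integer.Properties as ℤP
open import Algebra.Properties.AbelianGroup ℤP.+-0-abelianGroup
  using () renaming (∙-cancelˡ to +-cancelˡ-≡ℤ)
open import Data.Nat as ℕ using (ℕ; zero; suc; _+_; _*_; _∸_; _≡ᵇ_; _<_; _≤_; z≤n; s≤s)
open import Data.Nat.Tactic.RingSolver using (solve-∀)
open import Data.Nat.Combinatorics using (_C_; nC1≡n; nCk+nC[k+1]≡[n+1]C[k+1])
open import Data.Nat.DivMod using (_/_; m*n/n≡m)
import Data.Nat.Properties as ℕP
open import Data.Nat.Properties using (+-suc; ≡ᵇ⇒≡; ≡⇒≡ᵇ)
open import Algebra.Properties.CommutativeSemigroup ℕP.+-commutativeSemigroup
  using () renaming (interchange to +-interchange; x∙yz≈y∙xz to +-left-comm)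
open import Data.Product using (_×_; _,_; proj₁; proj₂)
open import Function using (_∘_; _⇔_; mk⇔; Equivalence)
open import Relation.Binary.PropositionalEquality
open import Relation.Nullary using (Dec; yes; no; ¬_; _×-dec_; ¬?; contradiction)
open import Relation.Nullary.Decidable using (⌊_⌋; isYes≗does; does-⇔; dec-false)
open import Relation.Unary using (Decidable)

count : ℕ → (List Step → Bool) → ℕ
count L P = length (filterᵇ P (allPaths L))

allPaths-length : ∀ L → All (λ p → length p ≡ L) (allPaths L)
allPaths-length zero    = refl ∷ []
allPaths-length (suc L) =
  concat⁺ (gmap⁺ (λ eq → cong suc eq ∷ cong suc eq ∷ []) (allPaths-length L))

length-filterᵇ-cong : ∀ {P Q : List Step → Bool} {ps} → All (λ p → P p ≡ Q p) ps →
                      length (filterᵇ P ps) ≡ length (filterᵇ Q ps)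
length-filterᵇ-cong []                          = refl
length-filterᵇ-cong {P} {Q} {p ∷ _} (eq ∷ eqs) rewrite eq with Q p
... | true  = cong suc (length-filterᵇ-cong eqs)
... | false = length-filterᵇ-cong eqs

count-cong : ∀ L {P Q : List Step → Bool} → (∀ p → length p ≡ L → P p ≡ Q p) →
             count L P ≡ count L Q
count-cong L P≗Q = length-filterᵇ-cong (All.map (P≗Q _) (allPaths-length L))

count-zero : ∀ P → count 0 P ≡ (if P [] then 1 else 0)
count-zero P with P []
... | true  = refl
... | false = refl

count-suc : ∀ L P → count (suc L) P ≡ count L (P ∘ (U ∷_)) + count L (P ∘ (D ∷_))
count-suc L P = go (allPaths L)
  where
  go : ∀ ps → length (filterᵇ P (concat (map (λ p → (U ∷ p) ∷ (D ∷ p) ∷ []) ps))) ≡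
              length (filterᵇ (P ∘ (U ∷_)) ps) + length (filterᵇ (P ∘ (D ∷_)) ps)
  go []      = refl
  go (p ∷ ps) with P (U ∷ p)
  ... | true  with P (D ∷ p)
  ...   | true  = cong suc (trans (cong suc (go ps)) (sym (+-suc _ _)))
  ...   | false = cong suc (go ps)
  go (p ∷ ps) | false with P (D ∷ p)
  ...   | true  = trans (cong suc (go ps)) (sym (+-suc _ _))
  ...   | false = go ps

count-partition : ∀ L {A B : List Step → Set} (A? : Decidable A) (B? : Decidable B) →
  count L (⌊_⌋ ∘ A?) ≡ count L (λ p → ⌊ A? p ×-dec B? p ⌋) + count L (λ p → ⌊ A? p ×-dec ¬? (B? p) ⌋)
count-partition L A? B? = go (allPaths L)
  where
  go : ∀ ps → length (filterᵇ (⌊_⌋ ∘ A?) ps) ≡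
              length (filterᵇ (λ p → ⌊ A? p ×-dec B? p ⌋) ps) +
              length (filterᵇ (λ p → ⌊ A? p ×-dec ¬? (B? p) ⌋) ps)
  go []       = refl
  go (p ∷ ps) with A? p | B? p
  ... | yes _ | yes _ = cong suc (go ps)
  ... | yes _ | no  _ = trans (cong suc (go ps)) (sym (+-suc _ _))
  ... | no  _ | _     = go ps

⌊⌋-⇔ : ∀ {a b} {A : Set a} {B : Set b} → A ⇔ B → (A? : Dec A) (B? : Dec B) → ⌊ A? ⌋ ≡ ⌊ B? ⌋
⌊⌋-⇔ A⇔B A? B? = trans (isYes≗does A?) (trans (does-⇔ A⇔B A? B?) (sym (isYes≗does B?)))

⌊⌋-×-dec : ∀ {a b} {A : Set a} {B : Set b} (A? : Dec A) (B? : Dec B) →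
           ⌊ A? ⌋ ∧ ⌊ B? ⌋ ≡ ⌊ A? ×-dec B? ⌋
⌊⌋-×-dec A? B? = trans (cong₂ _∧_ (isYes≗does A?) (isYes≗does B?)) (sym (isYes≗does (A? ×-dec B?)))

count-⇔ : ∀ L {A B : List Step → Set} (A? : Decidable A) (B? : Decidable B) →
          (∀ p → length p ≡ L → A p ⇔ B p) → count L (⌊_⌋ ∘ A?) ≡ count L (⌊_⌋ ∘ B?)
count-⇔ L A? B? A⇔B = count-cong L (λ p len → ⌊⌋-⇔ (A⇔B p len) (A? p) (B? p))

count-⊥ : ∀ L {A : List Step → Set} (A? : Decidable A) → (∀ p → length p ≡ L → ¬ A p) →
          count L (⌊_⌋ ∘ A?) ≡ 0
count-⊥ L A? ¬A =
  trans (count-cong L (λ p len → trans (isYes≗does (A? p)) (dec-false (A? p) (¬A p len)))) (none (allPaths L))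
  where
  none : ∀ ps → length (filterᵇ (λ _ → false) ps) ≡ 0
  none []       = refl
  none (_ ∷ ps) = none ps

below : (ℕ → ℕ) → ℕ → ℕ → ℕ
below f h       zero    = f h
below f zero    (suc e) = 0
below f (suc h) (suc e) = below f h e

below-cong : ∀ {f g : ℕ → ℕ} h e → (∀ x → x + e ≡ h → f x ≡ g x) → below f h e ≡ below g h e
below-cong h       zero    f≗g = f≗g h (ℕP.+-identityʳ h)
below-cong zero    (suc e) f≗g = refl
below-cong (suc h) (suc e) f≗g = below-cong h e (λ x eq → f≗g x (trans (+-suc x e) (cong suc eq)))

below-+-distrib : ∀ (f g : ℕ → ℕ) h e → below (λ x → f x + g x) h e ≡ below f h e + below g h e
below-+-distrib f g h       zero    = refl
below-+-distrib f g zero    (suc e) = refl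
below-+-distrib f g (suc h) (suc e) = below-+-distrib f g h e

below-*ʳ : ∀ (f : ℕ → ℕ) c h e → below (λ x → f x * c) h e ≡ below f h e * c
below-*ʳ f c h       zero    = refl
below-*ʳ f c zero    (suc e) = refl
below-*ʳ f c (suc h) (suc e) = below-*ʳ f c h e

below-sumTo : ∀ (F : ℕ → ℕ → ℕ) n h e →
              below (λ x → sumTo n (F x)) h e ≡ sumTo n (λ i → below (λ x → F x i) h e)
below-sumTo F zero    h e = refl
below-sumTo F (suc n) h e = trans (below-+-distrib (λ x → sumTo n (F x)) (λ x → F x (suc n)) h e)
                                  (cong (_+ below (λ x → F x (suc n)) h e) (below-sumTo F n h e))

below-0 : ∀ h e → below (λ _ → 0) h e ≡ 0
below-0 h       zero    = refl
below-0 zero    (suc e) = refl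
below-0 (suc h) (suc e) = below-0 h e

below-comm : ∀ (F : ℕ → ℕ → ℕ) h₁ e₁ h₂ e₂ →
             below (λ x → below (F x) h₂ e₂) h₁ e₁ ≡ below (λ y → below (λ x → F x y) h₁ e₁) h₂ e₂
below-comm F h₁       zero     h₂ e₂ = refl
below-comm F zero     (suc e₁) h₂ e₂ = sym (below-0 h₂ e₂)
below-comm F (suc h₁) (suc e₁) h₂ e₂ = below-comm F h₁ e₁ h₂ e₂

below-suc : ∀ (f : ℕ → ℕ) h e → below (λ x → below f x 1) h e ≡ below f h (suc e)
below-suc f h       zero    = refl
below-suc f zero    (suc e) = refl
below-suc f (suc h) (suc e) = below-suc f h e

sumTo-cong : ∀ n {f g : ℕ → ℕ} → (∀ i → i ≤ n → f i ≡ g i) → sumTo n f ≡ sumTo n g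
sumTo-cong zero    f≗g = f≗g 0 z≤n
sumTo-cong (suc n) f≗g =
  cong₂ _+_ (sumTo-cong n (λ i i≤n → f≗g i (ℕP.m≤n⇒m≤1+n i≤n))) (f≗g (suc n) ℕP.≤-refl)

sumTo-zero : ∀ n {f : ℕ → ℕ} → (∀ i → i ≤ n → f i ≡ 0) → sumTo n f ≡ 0
sumTo-zero zero    f≗0 = f≗0 0 z≤n
sumTo-zero (suc n) f≗0 =
  cong₂ _+_ (sumTo-zero n (λ i i≤n → f≗0 i (ℕP.m≤n⇒m≤1+n i≤n))) (f≗0 (suc n) ℕP.≤-refl)

sumTo-+ : ∀ n (f g : ℕ → ℕ) → sumTo n (λ i → f i + g i) ≡ sumTo n f + sumTo n g
sumTo-+ zero    f g = refl
sumTo-+ (suc n) f g =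
  trans (cong (_+ (f (suc n) + g (suc n))) (sumTo-+ n f g)) (+-interchange (sumTo n f) (sumTo n g) _ _)

sumTo-shift : ∀ n (f : ℕ → ℕ) → f 0 ≡ 0 → sumTo (suc n) f ≡ sumTo n (f ∘ suc)
sumTo-shift zero    f f0≡0 = cong (_+ f 1) f0≡0
sumTo-shift (suc n) f f0≡0 = cong (_+ f (suc (suc n))) (sumTo-shift n f f0≡0)

⋆-congˡ : ∀ n {f g : Series} (h : Series) → (∀ i → i ≤ n → f i ≡ g i) → (f ⋆ h) n ≡ (g ⋆ h) n
⋆-congˡ n h f≗g = sumTo-cong n (λ i i≤n → cong (_* h (n ∸ i)) (f≗g i i≤n))

⋆-congʳ : ∀ n (f : Series) {g h : Series} → (∀ i → i ≤ n → g i ≡ h i) → (f ⋆ g) n ≡ (f ⋆ h) n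
⋆-congʳ n f g≗h = sumTo-cong n (λ i _ → cong (f i *_) (g≗h (n ∸ i) (ℕP.m∸n≤m n i)))

⋆-distribʳ-+ : ∀ n (f g h : Series) → ((λ i → f i + g i) ⋆ h) n ≡ (f ⋆ h) n + (g ⋆ h) n
⋆-distribʳ-+ n f g h =
  trans (sumTo-cong n (λ i _ → ℕP.*-distribʳ-+ (h (n ∸ i)) (f i) (g i))) (sumTo-+ n _ _)

⋆-identityˡ : ∀ (f : Series) n → (oneS ⋆ f) n ≡ f n
⋆-identityˡ f n = trans (tail-vanishes n) (ℕP.+-identityʳ (f n))
  where
  tail-vanishes : ∀ m → sumTo m (λ i → oneS i * f (n ∸ i)) ≡ f n + 0
  tail-vanishes zero    = refl
  tail-vanishes (suc m) = trans (ℕP.+-identityʳ _) (tail-vanishes m)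

⋆-identityʳ : ∀ (f : Series) n → (f ⋆ oneS) n ≡ f n
⋆-identityʳ f zero    = ℕP.*-identityʳ (f 0)
⋆-identityʳ f (suc n) =
  cong₂ _+_ head-vanishes (trans (cong (λ x → f (suc n) * oneS x) (ℕP.n∸n≡0 n)) (ℕP.*-identityʳ _))
  where
  head-vanishes : sumTo n (λ i → f i * oneS (suc n ∸ i)) ≡ 0
  head-vanishes = sumTo-zero n (λ i i≤n →
    trans (cong (λ x → f i * oneS x) (ℕP.+-∸-assoc 1 i≤n)) (ℕP.*-zeroʳ (f i)))

below-⋆ : ∀ (f g : Series) n → below (f ⋆ g) n 1 ≡ ((λ i → below f i 1) ⋆ g) n
below-⋆ f g zero    = refl
below-⋆ f g (suc n) = sym (sumTo-shift n _ refl)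

0≤1+i∧1+i≢0⇔0≤i : ∀ {i} → (+ 0 ℤ.≤ + 1 ℤ.+ i × + 1 ℤ.+ i ≢ + 0) ⇔ + 0 ℤ.≤ i
0≤1+i∧1+i≢0⇔0≤i {+ n}           = mk⇔ (λ _ → +≤+ z≤n) (λ _ → +≤+ z≤n , λ ())
0≤1+i∧1+i≢0⇔0≤i { -[1+ zero ]}  = mk⇔ (λ (_ , ≢0) → contradiction refl ≢0) (λ ())
0≤1+i∧1+i≢0⇔0≤i { -[1+ suc n ]} = mk⇔ (λ { (() , _) }) (λ ())

⊖-nonneg⇒≤ : ∀ {L} x y → + L ≡ x ⊖ y → y ≤ x
⊖-nonneg⇒≤ x       zero    _  = z≤n
⊖-nonneg⇒≤ zero    (suc y) ()
⊖-nonneg⇒≤ (suc x) (suc y) eq = s≤s (⊖-nonneg⇒≤ x y (trans eq (ℤP.[1+m]⊖[1+n]≡m⊖n x y)))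

module _ (k : ℕ) where

  minY-≤-start : ∀ h p → minY k h p ℤ.≤ h
  minY-≤-start h []      = ℤP.≤-refl
  minY-≤-start h (_ ∷ _) = ℤP.i⊓j≤i h _

  minY-≤-endY : ∀ h p → minY k h p ℤ.≤ endY k h p
  minY-≤-endY h []      = ℤP.≤-refl
  minY-≤-endY h (s ∷ p) = ℤP.≤-trans (ℤP.i⊓j≤j h _) (minY-≤-endY (h ℤ.+ δ k s) p)

  endY-+ : ∀ c h p → endY k (c ℤ.+ h) p ≡ c ℤ.+ endY k h p
  endY-+ c h []      = refl
  endY-+ c h (s ∷ p) =
    trans (cong (λ x → endY k x p) (ℤP.+-assoc c h (δ k s))) (endY-+ c (h ℤ.+ δ k s) p)

  minY-+ : ∀ c h p → minY k (c ℤ.+ h) p ≡ c ℤ.+ minY k h p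
  minY-+ c h []      = refl
  minY-+ c h (s ∷ p) = begin
    (c ℤ.+ h) ⊓ minY k (c ℤ.+ h ℤ.+ δ k s) p    ≡⟨ cong (λ x → (c ℤ.+ h) ⊓ minY k x p) (ℤP.+-assoc c h _) ⟩
    (c ℤ.+ h) ⊓ minY k (c ℤ.+ (h ℤ.+ δ k s)) p  ≡⟨ cong ((c ℤ.+ h) ⊓_) (minY-+ c (h ℤ.+ δ k s) p) ⟩
    (c ℤ.+ h) ⊓ (c ℤ.+ minY k (h ℤ.+ δ k s) p)  ≡⟨ ℤP.mono-≤-distrib-⊓ (ℤP.+-monoʳ-≤ c) h _ ⟨
    c ℤ.+ (h ⊓ minY k (h ℤ.+ δ k s) p)          ∎
    where open ≡-Reasoning

  Walk : ℤ → ℕ → ℕ → List Step → Set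
  Walk h b n p = countD p ≡ n × endY k h p ≡ + b × + 0 ℤ.≤ minY k h p

  walk? : ∀ h b n → Decidable (Walk h b n)
  walk? h b n p = countD p ℕ.≟ n ×-dec endY k h p ℤ.≟ + b ×-dec + 0 ℤ.≤? minY k h p

  InD : ℕ → ℕ → ℕ → List Step → Set
  InD n α β p = + length p ≡ (+ (k * n) ℤ.+ + β) ℤ.- + α × Walk (+ α) β n p

  inD? : ∀ n α β → Decidable (InD n α β)
  inD? n α β p = + length p ℤ.≟ (+ (k * n) ℤ.+ + β) ℤ.- + α ×-dec walk? (+ α) β n p

  inDᵇ≡⌊inD?⌋ : ∀ n α β p → inDᵇ k n α β p ≡ ⌊ inD? n α β p ⌋
  inDᵇ≡⌊inD?⌋ n α β p = begin
    ⌊ len? ⌋ ∧ (⌊ cnt? ⌋ ∧ (⌊ end? ⌋ ∧ ⌊ min? ⌋)) ≡⟨ cong (λ x → ⌊ len? ⌋ ∧ (⌊ cnt? ⌋ ∧ x)) (⌊⌋-×-dec end? _) ⟩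
    ⌊ len? ⌋ ∧ (⌊ cnt? ⌋ ∧ ⌊ end? ×-dec min? ⌋) ≡⟨ cong (⌊ len? ⌋ ∧_) (⌊⌋-×-dec cnt? _) ⟩
    ⌊ len? ⌋ ∧ ⌊ walk? (+ α) β n p ⌋             ≡⟨ ⌊⌋-×-dec len? _ ⟩
    ⌊ inD? n α β p ⌋                            ∎
    where
    open ≡-Reasoning
    len? = + length p ℤ.≟ (+ (k * n) ℤ.+ + β) ℤ.- + α
    cnt? = countD p ℕ.≟ n
    end? = endY k (+ α) p ℤ.≟ + β
    min? = + 0 ℤ.≤? minY k (+ α) p

  Cnum-count : ∀ α β n → Cnum k α β n ≡ count ((k * n + β) ∸ α) (⌊_⌋ ∘ inD? n α β)
  Cnum-count α β n = count-cong ((k * n + β) ∸ α) (λ p _ → inDᵇ≡⌊inD?⌋ n α β p)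

  mCnum-count : ∀ α β m n → mCnum k α β m n ≡
    count ((k * n + β) ∸ α) (λ p → ⌊ inD? n α β p ×-dec minY k (+ α) p ℤ.≟ + m ⌋)
  mCnum-count α β m n = count-cong ((k * n + β) ∸ α) (λ p _ →
    trans (cong (_∧ _) (inDᵇ≡⌊inD?⌋ n α β p)) (⌊⌋-×-dec (inD? n α β p) _))

  target-shift : ∀ n c a b → (+ (k * n) ℤ.+ + (c + b)) ℤ.- + (c + a) ≡ (+ (k * n) ℤ.+ + b) ℤ.- + a
  target-shift n c a b = begin
    (+ (k * n) ℤ.+ + (c + b)) ℤ.- + (c + a)  ≡⟨ ℤP.m-n≡m⊖n (k * n + (c + b)) (c + a) ⟩
    (k * n + (c + b)) ⊖ (c + a)              ≡⟨ cong (_⊖ (c + a)) (+-left-comm (k * n) c b) ⟩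
    (c + (k * n + b)) ⊖ (c + a)              ≡⟨ ℤP.+-cancelˡ-⊖ c (k * n + b) a ⟩
    (k * n + b) ⊖ a                          ≡⟨ ℤP.m-n≡m⊖n (k * n + b) a ⟨
    (+ (k * n) ℤ.+ + b) ℤ.- + a              ∎
    where open ≡-Reasoning

  endY-shift : ∀ c a b p → endY k (+ (c + a)) p ≡ + (c + b) ⇔ endY k (+ a) p ≡ + b
  endY-shift c a b p = mk⇔ (λ e → +-cancelˡ-≡ℤ (+ c) _ _ (trans (sym (endY-+ (+ c) (+ a) p)) e))
                           (λ e → trans (endY-+ (+ c) (+ a) p) (cong (ℤ._+_ (+ c)) e))

  minY-shift : ∀ c a p → minY k (+ (c + a)) p ≡ + c ⇔ minY k (+ a) p ≡ + 0
  minY-shift c a p =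
    mk⇔ (λ e → +-cancelˡ-≡ℤ (+ c) _ _ (trans (sym (minY-+ (+ c) (+ a) p)) (trans e (sym (ℤP.+-identityʳ (+ c))))))
        (λ e → trans (minY-+ (+ c) (+ a) p) (trans (cong (ℤ._+_ (+ c)) e) (ℤP.+-identityʳ (+ c))))

  InD-min-shift : ∀ n c a b p →
    (InD n (c + a) (c + b) p × minY k (+ (c + a)) p ≡ + c) ⇔ (InD n a b p × minY k (+ a) p ≡ + 0)
  InD-min-shift n c a b p = mk⇔
    (λ ((l , cnt , e , _) , m) → (trans l (target-shift n c a b) , cnt , Equivalence.to (endY-shift c a b p) e ,
                                   ℤP.≤-reflexive (sym (Equivalence.to (minY-shift c a p) m))) ,
                                  Equivalence.to (minY-shift c a p) m)
    (λ ((l , cnt , e , _) , m) → (trans l (sym (target-shift n c a b)) , cnt , Equivalence.from (endY-shift c a b p) e ,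
                                   subst (+ 0 ℤ.≤_) (sym (Equivalence.from (minY-shift c a p) m)) (+≤+ z≤n)) ,
                                  Equivalence.from (minY-shift c a p) m)

  mCnum-shift : ∀ c a b n → mCnum k (c + a) (c + b) c n ≡ mCnum k a b 0 n
  mCnum-shift c a b n = begin
    mCnum k (c + a) (c + b) c n
      ≡⟨ mCnum-count (c + a) (c + b) c n ⟩
    count ((k * n + (c + b)) ∸ (c + a)) (⌊_⌋ ∘ lifted)
      ≡⟨ cong (λ L → count L (⌊_⌋ ∘ lifted)) length≡ ⟩
    count ((k * n + b) ∸ a) (⌊_⌋ ∘ lifted)
      ≡⟨ count-⇔ ((k * n + b) ∸ a) lifted lowered (λ p _ → InD-min-shift n c a b p) ⟩
    count ((k * n + b) ∸ a) (⌊_⌋ ∘ lowered)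
      ≡⟨ mCnum-count a b 0 n ⟨
    mCnum k a b 0 n
      ∎
    where
    open ≡-Reasoning
    lifted : Decidable (λ p → InD n (c + a) (c + b) p × minY k (+ (c + a)) p ≡ + c)
    lifted p = inD? n (c + a) (c + b) p ×-dec minY k (+ (c + a)) p ℤ.≟ + c
    lowered : Decidable (λ p → InD n a b p × minY k (+ a) p ≡ + 0)
    lowered p = inD? n a b p ×-dec minY k (+ a) p ℤ.≟ + 0
    length≡ : (k * n + (c + b)) ∸ (c + a) ≡ (k * n + b) ∸ a
    length≡ = trans (cong (_∸ (c + a)) (+-left-comm (k * n) c b)) (ℕP.[m+n]∸[m+o]≡n∸o c (k * n + b) a)

  mCnum-end-0 : ∀ a n → mCnum k a 0 0 n ≡ Cnum k a 0 n
  mCnum-end-0 a n = trans (mCnum-count a 0 0 n)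
    (trans (count-⇔ ((k * n + 0) ∸ a) (λ p → inD? n a 0 p ×-dec minY k (+ a) p ℤ.≟ + 0) (inD? n a 0)
                    (λ p _ → mk⇔ proj₁ (λ d → d , min≡0 p d)))
           (sym (Cnum-count a 0 n)))
    where
    min≡0 : ∀ p → InD n a 0 p → minY k (+ a) p ≡ + 0
    min≡0 p (_ , _ , e , nn) = ℤP.≤-antisym (subst (minY k (+ a) p ℤ.≤_) e (minY-≤-endY (+ a) p)) nn

  Cnum-min-split : ∀ a b n → Cnum k a (suc b) n ≡ mCnum k a (suc b) 0 n + below (λ x → Cnum k x b n) a 1
  Cnum-min-split a b n = begin
    Cnum k a (suc b) n
      ≡⟨ Cnum-count a (suc b) n ⟩
    count L (⌊_⌋ ∘ inD? n a (suc b))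
      ≡⟨ count-partition L (inD? n a (suc b)) (λ p → minY k (+ a) p ℤ.≟ + 0) ⟩
    count L (λ p → ⌊ inD? n a (suc b) p ×-dec minY k (+ a) p ℤ.≟ + 0 ⌋) + count L (⌊_⌋ ∘ aboveZero a)
      ≡⟨ cong₂ _+_ (sym (mCnum-count a (suc b) 0 n)) (count-aboveZero a) ⟩
    mCnum k a (suc b) 0 n + below (λ x → Cnum k x b n) a 1
      ∎
    where
    open ≡-Reasoning
    L = (k * n + suc b) ∸ a
    aboveZero : ∀ a → Decidable (λ p → InD n a (suc b) p × minY k (+ a) p ≢ + 0)
    aboveZero a p = inD? n a (suc b) p ×-dec ¬? (minY k (+ a) p ℤ.≟ + 0)
    count-aboveZero : ∀ a → count ((k * n + suc b) ∸ a) (⌊_⌋ ∘ aboveZero a) ≡ below (λ x → Cnum k x b n) a 1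
    count-aboveZero zero    = count-⊥ (k * n + suc b) (aboveZero 0) (λ p _ ((_ , _ , _ , nn) , ≢0) →
                                ≢0 (ℤP.≤-antisym (minY-≤-start (+ 0) p) nn))
    count-aboveZero (suc a) = begin
      count ((k * n + suc b) ∸ suc a) (⌊_⌋ ∘ aboveZero (suc a))
        ≡⟨ cong (λ L → count (L ∸ suc a) (⌊_⌋ ∘ aboveZero (suc a))) (+-suc (k * n) b) ⟩
      count ((k * n + b) ∸ a) (⌊_⌋ ∘ aboveZero (suc a))
        ≡⟨ count-⇔ ((k * n + b) ∸ a) (aboveZero (suc a)) (inD? n a b) (λ p _ → lower p) ⟩
      count ((k * n + b) ∸ a) (⌊_⌋ ∘ inD? n a b)
        ≡⟨ Cnum-count a b n ⟨
      Cnum k a b n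
        ∎
      where
      lower : ∀ p → (InD n (1 + a) (1 + b) p × minY k (+ (1 + a)) p ≢ + 0) ⇔ InD n a b p
      lower p = mk⇔
        (λ ((l , cnt , e , nn) , ≢0) → trans l (target-shift n 1 a b) , cnt , Equivalence.to (endY-shift 1 a b p) e ,
           Equivalence.to 0≤1+i∧1+i≢0⇔0≤i (subst (+ 0 ℤ.≤_) min≡ nn , ≢0 ∘ trans min≡))
        (λ (l , cnt , e , nn) → (trans l (sym (target-shift n 1 a b)) , cnt , Equivalence.from (endY-shift 1 a b p) e ,
           subst (+ 0 ℤ.≤_) (sym min≡) (proj₁ (Equivalence.from 0≤1+i∧1+i≢0⇔0≤i nn))) ,
           proj₂ (Equivalence.from 0≤1+i∧1+i≢0⇔0≤i nn) ∘ trans (sym min≡))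
        where
        min≡ : minY k (+ (1 + a)) p ≡ + 1 ℤ.+ minY k (+ a) p
        min≡ = minY-+ (+ 1) (+ a) p

pascal-below : ∀ N n → suc N C n ≡ below (N C_) n 1 + N C n
pascal-below N zero    = refl
pascal-below N (suc n) = sym (nCk+nC[k+1]≡[n+1]C[k+1] N n)

C-absorb : ∀ N r → suc r * (suc N C suc r) ≡ suc N * (N C r)
C-absorb zero    zero    = refl
C-absorb zero    (suc r) = ℕP.*-zeroʳ (suc (suc r))
C-absorb (suc N) zero    = trans (ℕP.*-identityˡ _) (trans (nC1≡n (suc (suc N))) (sym (ℕP.*-identityʳ _)))
C-absorb (suc N) (suc r) = begin
  suc (suc r) * (suc (suc N) C suc (suc r))
    ≡⟨ cong (suc (suc r) *_) (nCk+nC[k+1]≡[n+1]C[k+1] (suc N) (suc r)) ⟨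
  suc (suc r) * (suc N C suc r + suc N C suc (suc r))
    ≡⟨ ℕP.*-distribˡ-+ (suc (suc r)) (suc N C suc r) _ ⟩
  suc N C suc r + suc r * (suc N C suc r) + suc (suc r) * (suc N C suc (suc r))
    ≡⟨ cong₂ (λ x y → suc N C suc r + x + y) (C-absorb N r) (C-absorb N (suc r)) ⟩
  suc N C suc r + suc N * (N C r) + suc N * (N C suc r)
    ≡⟨ ℕP.+-assoc (suc N C suc r) _ _ ⟩
  suc N C suc r + (suc N * (N C r) + suc N * (N C suc r))
    ≡⟨ cong (suc N C suc r ℕ.+_) (ℕP.*-distribˡ-+ (suc N) (N C r) _) ⟨
  suc N C suc r + suc N * (N C r + N C suc r)
    ≡⟨ cong (λ x → suc N C suc r + suc N * x) (nCk+nC[k+1]≡[n+1]C[k+1] N r) ⟩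
  suc (suc N) * (suc N C suc r)
    ∎
  where open ≡-Reasoning

C-absorb-pascal : ∀ N r → suc r * (N C suc r) + suc r * (N C r) ≡ suc N * (N C r)
C-absorb-pascal N r = begin
  suc r * (N C suc r) + suc r * (N C r)  ≡⟨ ℕP.+-comm (suc r * (N C suc r)) _ ⟩
  suc r * (N C r) + suc r * (N C suc r)  ≡⟨ ℕP.*-distribˡ-+ (suc r) (N C r) _ ⟨
  suc r * (N C r + N C suc r)            ≡⟨ cong (suc r *_) (nCk+nC[k+1]≡[n+1]C[k+1] N r) ⟩
  suc r * (suc N C suc r)                ≡⟨ C-absorb N r ⟩
  suc N * (N C r)                        ∎
  where open ≡-Reasoning

C-ratio : ∀ M n d → suc M ≡ suc n * suc d → M C suc n ≡ d * (M C n)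
C-ratio M n d eq = ℕP.*-cancelˡ-≡ _ _ (suc n) (ℕP.+-cancelʳ-≡ (suc n * (M C n)) _ _ (begin
  suc n * (M C suc n) + suc n * (M C n)    ≡⟨ C-absorb-pascal M n ⟩
  suc M * (M C n)                          ≡⟨ cong (_* (M C n)) eq ⟩
  suc n * suc d * (M C n)                  ≡⟨ distrib (suc n) d (M C n) ⟩
  suc n * (d * (M C n)) + suc n * (M C n)  ∎))
  where
  open ≡-Reasoning
  distrib : ∀ a d c → a * suc d * c ≡ a * (d * c) + a * c
  distrib = solve-∀

fuss-catalan-from-ballot : ∀ r d q N → N ≡ suc r * suc d → q + d * (N C r) ≡ N C suc r →
                           suc N C suc r ≡ q * suc N
fuss-catalan-from-ballot r d q N N≡ ballot = ℕP.*-cancelˡ-≡ _ _ (suc r) (begin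
  suc r * (suc N C suc r)  ≡⟨ C-absorb N r ⟩
  suc N * (N C r)          ≡⟨ cong (suc N *_) r+1*q≡ ⟨
  suc N * (suc r * q)      ≡⟨ swap (suc N) (suc r) q ⟩
  suc r * (q * suc N)      ∎)
  where
  open ≡-Reasoning
  swap : ∀ a b c → a * (b * c) ≡ b * (c * a)
  swap = solve-∀
  expand : ∀ r d q c → suc r * q + suc r * suc d * c ≡ suc r * (q + d * c) + suc r * c
  expand = solve-∀
  r+1*q≡ : suc r * q ≡ N C r
  r+1*q≡ = ℕP.+-cancelʳ-≡ (N * (N C r)) _ _ (begin
    suc r * q + N * (N C r)                 ≡⟨ cong (λ x → suc r * q + x * (N C r)) N≡ ⟩
    suc r * q + suc r * suc d * (N C r)     ≡⟨ expand r d q (N C r) ⟩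
    suc r * (q + d * (N C r)) + suc r * (N C r) ≡⟨ cong (λ x → suc r * x + suc r * (N C r)) ballot ⟩
    suc r * (N C suc r) + suc r * (N C r)   ≡⟨ C-absorb-pascal N r ⟩
    suc N * (N C r)                         ≡⟨ ℕP.+-comm (N C r) _ ⟩
    N * (N C r) + N C r                     ≡⟨ ℕP.+-comm _ (N C r) ⟩
    N C r + N * (N C r)                     ∎)

module Walks (j : ℕ) where

  d : ℕ
  d = suc j

  k : ℕ
  k = suc d

  -- afterD F h n = F (h ∸ d) (n ∸ 1), or 0 when a first step D from height h is impossible
  afterD : (ℕ → ℕ → ℕ) → ℕ → ℕ → ℕ
  afterD F h n = below (λ n′ → below (λ h′ → F h′ n′) h d) n 1

  -- _≡ᵇ_ makes walks 0 (suc h) (suc b) n reduce to walks 0 h b n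
  walks : ℕ → ℕ → ℕ → ℕ → ℕ
  walks zero    h b n = if (h ≡ᵇ b) ∧ (n ≡ᵇ 0) then 1 else 0
  walks (suc L) h b n = walks L (suc h) b n + afterD (λ h′ n′ → walks L h′ b n′) h n

  ⌊walk?-[]⌋ : ∀ h b n → ⌊ walk? k (+ h) b n [] ⌋ ≡ (h ≡ᵇ b) ∧ (n ≡ᵇ 0)
  ⌊walk?-[]⌋ h b n =
    trans (⌊⌋-⇔ (mk⇔ to from) (walk? k (+ h) b n []) (T? _)) (isYes≗does (T? ((h ≡ᵇ b) ∧ (n ≡ᵇ 0))))
    where
    to : Walk k (+ h) b n [] → T ((h ≡ᵇ b) ∧ (n ≡ᵇ 0))
    to (refl , refl , _) = Equivalence.from T-∧ (≡⇒≡ᵇ h h refl , _)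
    from : T ((h ≡ᵇ b) ∧ (n ≡ᵇ 0)) → Walk k (+ h) b n []
    from t with Equivalence.to T-∧ t
    ... | h≡b , n≡0 = sym (≡ᵇ⇒≡ n 0 n≡0) , cong +_ (≡ᵇ⇒≡ h b h≡b) , +≤+ z≤n

  walk-U : ∀ h b n p → Walk k (+ h) b n (U ∷ p) ⇔ Walk k (+ suc h) b n p
  walk-U h b n p = mk⇔ (λ (c , e , m) → c , subst (λ x → endY k x p ≡ + b) h+1 e ,
                                         subst (λ x → + 0 ℤ.≤ minY k x p) h+1 (ℤP.≤-trans m (ℤP.i⊓j≤j _ _)))
                       (λ (c , e , m) → c , subst (λ x → endY k x p ≡ + b) (sym h+1) e ,
                                         ℤP.⊓-glb (+≤+ z≤n) (subst (λ x → + 0 ℤ.≤ minY k x p) (sym h+1) m))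
    where
    h+1 : + h ℤ.+ + 1 ≡ + suc h
    h+1 = cong +_ (ℕP.+-comm h 1)

  walk-D : ∀ h b n p → Walk k (+ h) b (suc n) (D ∷ p) ⇔ Walk k (h ⊖ d) b n p
  walk-D h b n p = mk⇔ (λ (c , e , m) → ℕP.suc-injective c , e , ℤP.≤-trans m (ℤP.i⊓j≤j _ _))
                       (λ (c , e , m) → cong suc c , e , ℤP.⊓-glb (+≤+ z≤n) m)

  walk-negative : ∀ e b n p → ¬ Walk k -[1+ e ] b n p
  walk-negative e b n p (_ , _ , m) with ℤP.≤-trans m (minY-≤-start k -[1+ e ] p)
  ... | ()

  count-walk-⊖ : ∀ L b n h e →
    count L (⌊_⌋ ∘ walk? k (h ⊖ e) b n) ≡ below (λ x → count L (⌊_⌋ ∘ walk? k (+ x) b n)) h e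
  count-walk-⊖ L b n h       zero    = refl
  count-walk-⊖ L b n zero    (suc e) = count-⊥ L (walk? k -[1+ e ] b n) (λ p _ → walk-negative e b n p)
  count-walk-⊖ L b n (suc h) (suc e) =
    trans (cong (λ x → count L (⌊_⌋ ∘ walk? k x b n)) (ℤP.[1+m]⊖[1+n]≡m⊖n h e)) (count-walk-⊖ L b n h e)

  count-walk : ∀ L h b n → count L (⌊_⌋ ∘ walk? k (+ h) b n) ≡ walks L h b n
  count-walk zero h b n =
    trans (count-zero (⌊_⌋ ∘ walk? k (+ h) b n)) (cong (λ x → if x then 1 else 0) (⌊walk?-[]⌋ h b n))
  count-walk (suc L) h b n = trans (count-suc L (⌊_⌋ ∘ walk? k (+ h) b n)) (cong₂ _+_ first-U (first-D n))
    where
    first-U : count L (λ p → ⌊ walk? k (+ h) b n (U ∷ p) ⌋) ≡ walks L (suc h) b n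
    first-U = trans (count-⇔ L _ (walk? k (+ suc h) b n) (λ p _ → walk-U h b n p)) (count-walk L (suc h) b n)
    first-D : ∀ n → count L (λ p → ⌊ walk? k (+ h) b n (D ∷ p) ⌋) ≡ afterD (λ x → walks L x b) h n
    first-D zero    = count-⊥ L (λ p → walk? k (+ h) b 0 (D ∷ p)) (λ p _ (c , _) → ℕP.0≢1+n (sym c))
    first-D (suc n) = begin
      count L (λ p → ⌊ walk? k (+ h) b (suc n) (D ∷ p) ⌋)
        ≡⟨ count-⇔ L _ (walk? k (h ⊖ d) b n) (λ p _ → walk-D h b n p) ⟩
      count L (⌊_⌋ ∘ walk? k (h ⊖ d) b n)
        ≡⟨ count-walk-⊖ L b n h d ⟩
      below (λ x → count L (⌊_⌋ ∘ walk? k (+ x) b n)) h d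
        ≡⟨ below-cong h d (λ x _ → count-walk L x b n) ⟩
      below (λ x → walks L x b n) h d
        ∎
      where open ≡-Reasoning

  k*suc : ∀ n b → k * suc n + b ≡ suc (k * n + b + d)
  k*suc = arith j
    where
    arith : ∀ j n b → suc (suc j) * suc n + b ≡ suc (suc (suc j) * n + b + suc j)
    arith = solve-∀

  paths : ℕ → ℕ → Series
  paths a b n = walks ((k * n + b) ∸ a) a b n

  walks-paths : ∀ L a b n → L + a ≡ k * n + b → walks L a b n ≡ paths a b n
  walks-paths L a b n eq =
    cong (λ x → walks x a b n) (sym (trans (cong (_∸ a) (sym eq)) (ℕP.m+n∸n≡m L a)))

  walks-0-≢ : ∀ {a b} n → a ≢ b → walks 0 a b n ≡ 0
  walks-0-≢ {a} {b} n a≢b with a ≡ᵇ b | ≡ᵇ⇒≡ a b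
  ... | true  | a≡b = contradiction (a≡b _) a≢b
  ... | false | _   = refl

  paths-length-zero : ∀ a b n → k * n + b ≤ a → paths a b n ≡ walks 0 a b n
  paths-length-zero a b n le = cong (λ x → walks x a b n) (ℕP.m≤n⇒m∸n≡0 le)

  paths-vanish : ∀ a b n → k * n + b < a → paths a b n ≡ 0
  paths-vanish a b n lt = trans (paths-length-zero a b n (ℕP.<⇒≤ lt)) (walks-0-≢ n a≢b)
    where
    a≢b : a ≢ b
    a≢b refl = ℕP.<⇒≱ lt (ℕP.m≤n+m a (k * n))

  afterD-cong : ∀ {F G : ℕ → ℕ → ℕ} h n →
                (∀ x n′ → x + d ≡ h → suc n′ ≡ n → F x n′ ≡ G x n′) → afterD F h n ≡ afterD G h n
  afterD-cong h zero    F≗G = refl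
  afterD-cong h (suc n) F≗G = below-cong h d (λ x eq → F≗G x n eq refl)

  afterD-0 : ∀ F n → afterD F 0 n ≡ 0
  afterD-0 F zero    = refl
  afterD-0 F (suc n) = refl

  afterD-+-distrib : ∀ F G h n → afterD (λ x n′ → F x n′ + G x n′) h n ≡ afterD F h n + afterD G h n
  afterD-+-distrib F G h zero    = refl
  afterD-+-distrib F G h (suc n) = below-+-distrib (λ x → F x n) (λ x → G x n) h d

  afterD-below : ∀ F h n → afterD (λ x n′ → below (λ y → F y n′) x 1) (suc h) n ≡ afterD F h n
  afterD-below F h zero    = refl
  afterD-below F h (suc n) = below-suc (λ y → F y n) (suc h) d

  afterD-⋆ : ∀ (F : ℕ → Series) (g : Series) h n →
             afterD (λ x → F x ⋆ g) h n ≡ ((λ i → afterD F h i) ⋆ g) n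
  afterD-⋆ F g h n =
    trans (below-cong n 1 (λ m _ → below-⋆-pointwise m)) (below-⋆ (λ i → below (λ x → F x i) h d) g n)
    where
    below-⋆-pointwise : ∀ m → below (λ x → (F x ⋆ g) m) h d ≡ ((λ i → below (λ x → F x i) h d) ⋆ g) m
    below-⋆-pointwise m = trans (below-sumTo (λ x i → F x i * g (m ∸ i)) m h d)
                                (sumTo-cong m (λ i _ → below-*ʳ (λ x → F x i) (g (m ∸ i)) h d))

  afterD-paths-vanish : ∀ {a b} n → k * n + b ≤ a → afterD (λ x → paths x b) a n ≡ 0
  afterD-paths-vanish zero    le = refl
  afterD-paths-vanish {a} {b} (suc n) le = trans (below-cong a d (λ x eq → paths-vanish x b n (lt x eq))) (below-0 a d)
    where
    lt : ∀ x → x + d ≡ a → k * n + b < x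
    lt x refl = ℕP.+-cancelʳ-< d _ x (subst (_≤ x + d) (k*suc n b) le)

  paths-first-step : ∀ a b n → a < k * n + b → paths a b n ≡ paths (suc a) b n + afterD (λ x → paths x b) a n
  paths-first-step a b n lt = begin
    paths a b n
      ≡⟨ walks-paths (suc L) a b n L+1+a ⟨
    walks L (suc a) b n + afterD (λ x → walks L x b) a n
      ≡⟨ cong₂ _+_ (walks-paths L (suc a) b n L+a+1) (afterD-cong a n shorter) ⟩
    paths (suc a) b n + afterD (λ x → paths x b) a n
      ∎
    where
    open ≡-Reasoning
    L = (k * n + b) ∸ suc a
    L+a+1 : L + suc a ≡ k * n + b
    L+a+1 = ℕP.m∸n+n≡m lt
    L+1+a : suc L + a ≡ k * n + b
    L+1+a = trans (sym (+-suc L a)) L+a+1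
    shorter : ∀ x n′ → x + d ≡ a → suc n′ ≡ n → walks L x b n′ ≡ paths x b n′
    shorter x n′ refl refl = walks-paths L x b n′ (ℕP.+-cancelʳ-≡ d _ _ (ℕP.suc-injective (begin
      suc (L + x + d)       ≡⟨ cong suc (ℕP.+-assoc L x d) ⟩
      suc (L + (x + d))     ≡⟨ +-suc L (x + d) ⟨
      L + suc (x + d)       ≡⟨ L+a+1 ⟩
      k * suc n′ + b        ≡⟨ k*suc n′ b ⟩
      suc (k * n′ + b + d)  ∎)))

  k*0 : k * 0 + 0 ≡ 0
  k*0 = cong (_+ 0) (ℕP.*-zeroʳ k)

  paths-0-0 : ∀ n → paths 0 0 n ≡ oneS n + paths 1 0 n
  paths-0-0 zero    = trans (paths-length-zero 0 0 0 (ℕP.≤-reflexive k*0))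
                            (cong (1 ℕ.+_) (sym (paths-vanish 1 0 0 (ℕP.≤-reflexive (cong suc k*0)))))
  paths-0-0 (suc n) = trans (paths-first-step 0 0 (suc n) (subst (0 <_) (sym (k*suc n 0)) (s≤s z≤n)))
                            (ℕP.+-identityʳ (paths 1 0 (suc n)))

  paths-suc-0 : ∀ a i → paths (suc a) 0 i ≡ paths (suc (suc a)) 0 i + afterD (λ x → paths x 0) (suc a) i
  paths-suc-0 a i with suc a ℕ.<? k * i + 0
  ... | yes lt = paths-first-step (suc a) 0 i lt
  ... | no  ≮ = trans (paths-length-zero (suc a) 0 i (ℕP.≮⇒≥ ≮))
                      (sym (cong₂ _+_ (paths-vanish (suc (suc a)) 0 i (s≤s (ℕP.≮⇒≥ ≮)))
                                      (afterD-paths-vanish i (ℕP.≮⇒≥ ≮))))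

  bound-after-D : ∀ L x n b → k * suc n + b ≤ suc L + (x + d) → k * n + b ≤ L + x
  bound-after-D L x n b bd = ℕP.+-cancelʳ-≤ d _ _ (ℕP.≤-pred (begin
    suc (k * n + b + d)  ≡⟨ k*suc n b ⟨
    k * suc n + b        ≤⟨ bd ⟩
    suc L + (x + d)      ≡⟨ cong suc (ℕP.+-assoc L x d) ⟨
    suc (L + x + d)      ∎))
    where open ℕP.≤-Reasoning

  Convolution : ℕ → ℕ → ℕ → Set
  Convolution a b n = paths a (suc b) n ≡ (paths a 0 ⋆ paths 0 b) n + below (λ x → paths x b n) a 1

  convolution-short : ∀ a b n → k * n + suc b ≤ a → Convolution a b n
  convolution-short zero    b n le = contradiction (subst (_≤ 0) (+-suc (k * n) b) le) λ ()
  convolution-short (suc a) b n le = begin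
    paths (suc a) (suc b) n                        ≡⟨ paths-length-zero (suc a) (suc b) n le ⟩
    walks 0 a b n                                  ≡⟨ paths-length-zero a b n le′ ⟨
    0 + paths a b n                                ≡⟨ cong (_+ paths a b n) (sumTo-zero n no-return) ⟨
    (paths (suc a) 0 ⋆ paths 0 b) n + paths a b n  ∎
    where
    open ≡-Reasoning
    le′ : k * n + b ≤ a
    le′ = ℕP.≤-pred (subst (_≤ suc a) (+-suc (k * n) b) le)
    no-return : ∀ i → i ≤ n → paths (suc a) 0 i * paths 0 b (n ∸ i) ≡ 0
    no-return i i≤n = cong (_* paths 0 b (n ∸ i))
      (paths-vanish (suc a) 0 i (s≤s (ℕP.≤-trans (ℕP.+-mono-≤ (ℕP.*-monoʳ-≤ k i≤n) z≤n) le′)))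

  convolution-0 : ∀ b n → 0 < k * n + suc b → Convolution 1 b n → Convolution 0 b n
  convolution-0 b n lt conv₁ = begin
    paths 0 (suc b) n
      ≡⟨ paths-first-step 0 (suc b) n lt ⟩
    paths 1 (suc b) n + afterD (λ x → paths x (suc b)) 0 n
      ≡⟨ cong (paths 1 (suc b) n ℕ.+_) (afterD-0 (λ x → paths x (suc b)) n) ⟩
    paths 1 (suc b) n + 0
      ≡⟨ ℕP.+-identityʳ _ ⟩
    paths 1 (suc b) n
      ≡⟨ conv₁ ⟩
    (paths 1 0 ⋆ paths 0 b) n + paths 0 b n
      ≡⟨ ℕP.+-comm _ (paths 0 b n) ⟩
    paths 0 b n + (paths 1 0 ⋆ paths 0 b) n
      ≡⟨ cong (_+ (paths 1 0 ⋆ paths 0 b) n) (⋆-identityˡ (paths 0 b) n) ⟨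
    (oneS ⋆ paths 0 b) n + (paths 1 0 ⋆ paths 0 b) n
      ≡⟨ ⋆-distribʳ-+ n oneS (paths 1 0) (paths 0 b) ⟨
    ((λ i → oneS i + paths 1 0 i) ⋆ paths 0 b) n
      ≡⟨ ⋆-congˡ n (paths 0 b) (λ i _ → paths-0-0 i) ⟨
    (paths 0 0 ⋆ paths 0 b) n
      ≡⟨ ℕP.+-identityʳ _ ⟨
    (paths 0 0 ⋆ paths 0 b) n + 0
      ∎
    where open ≡-Reasoning

  convolution-suc : ∀ a b n → suc a < k * n + suc b → Convolution (suc (suc a)) b n →
                    (∀ x n′ → x + d ≡ suc a → suc n′ ≡ n → Convolution x b n′) → Convolution (suc a) b n
  convolution-suc a b n lt conv₂ convD = begin
    paths (suc a) (suc b) n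
      ≡⟨ paths-first-step (suc a) (suc b) n lt ⟩
    paths (suc (suc a)) (suc b) n + afterD (λ x → paths x (suc b)) (suc a) n
      ≡⟨ cong₂ _+_ conv₂ first-D ⟩
    (S₂ + paths (suc a) b n) + (Sᴰ + afterD (λ x → paths x b) a n)
      ≡⟨ +-interchange S₂ (paths (suc a) b n) Sᴰ _ ⟩
    (S₂ + Sᴰ) + (paths (suc a) b n + afterD (λ x → paths x b) a n)
      ≡⟨ cong₂ _+_ (⋆-distribʳ-+ n (paths (suc (suc a)) 0) (afterD (λ x → paths x 0) (suc a)) (paths 0 b))
                   (paths-first-step a b n lt′) ⟨
    ((λ i → paths (suc (suc a)) 0 i + afterD (λ x → paths x 0) (suc a) i) ⋆ paths 0 b) n + paths a b n
      ≡⟨ cong (_+ paths a b n) (⋆-congˡ n (paths 0 b) (λ i _ → paths-suc-0 a i)) ⟨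
    (paths (suc a) 0 ⋆ paths 0 b) n + paths a b n
      ∎
    where
    open ≡-Reasoning
    S₂ = (paths (suc (suc a)) 0 ⋆ paths 0 b) n
    Sᴰ = (afterD (λ x → paths x 0) (suc a) ⋆ paths 0 b) n
    lt′ : a < k * n + b
    lt′ = ℕP.≤-pred (subst (suc (suc a) ≤_) (+-suc (k * n) b) lt)
    first-D : afterD (λ x → paths x (suc b)) (suc a) n ≡ Sᴰ + afterD (λ x → paths x b) a n
    first-D = begin
      afterD (λ x → paths x (suc b)) (suc a) n
        ≡⟨ afterD-cong (suc a) n convD ⟩
      afterD (λ x n′ → (paths x 0 ⋆ paths 0 b) n′ + below (λ y → paths y b n′) x 1) (suc a) n
        ≡⟨ afterD-+-distrib (λ x → paths x 0 ⋆ paths 0 b) (λ x n′ → below (λ y → paths y b n′) x 1) (suc a) n ⟩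
      afterD (λ x → paths x 0 ⋆ paths 0 b) (suc a) n + afterD (λ x n′ → below (λ y → paths y b n′) x 1) (suc a) n
        ≡⟨ cong₂ _+_ (afterD-⋆ (λ x → paths x 0) (paths 0 b) (suc a) n) (afterD-below (λ y → paths y b) a n) ⟩
      Sᴰ + afterD (λ x → paths x b) a n
        ∎

  paths-convolution : ∀ a b n → Convolution a b n
  paths-convolution a b n = bounded (k * n + suc b) a n (ℕP.m≤m+n _ a)
    where
    bounded : ∀ L a n → k * n + suc b ≤ L + a → Convolution a b n
    bounded zero    a       n bd = convolution-short a b n bd
    bounded (suc L) a       n bd with k * n + suc b ℕ.≤? a
    bounded (suc L) a       n bd | yes le = convolution-short a b n le
    bounded (suc L) zero    n bd | no  gt = convolution-0 b n (ℕP.≰⇒> gt)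
      (bounded L 1 n (subst (k * n + suc b ≤_) (trans (ℕP.+-identityʳ (suc L)) (ℕP.+-comm 1 L)) bd))
    bounded (suc L) (suc a) n bd | no  gt = convolution-suc a b n (ℕP.≰⇒> gt)
      (bounded L (suc (suc a)) n (subst (k * n + suc b ≤_) (sym (+-suc L (suc a))) bd))
      (λ x n′ eq eq′ → bounded L x n′ (bound-after-D L x n′ (suc b)
        (subst₂ (λ z m → k * m + suc b ≤ suc L + z) (sym eq) (sym eq′) bd)))

  below-afterD : ∀ (G : ℕ → ℕ → ℕ → ℕ) c e h n →
                 below (λ y → afterD (G y) h n) c e ≡ afterD (λ x n′ → below (λ y → G y x n′) c e) h n
  below-afterD G c e h n = trans (below-comm (λ y n′ → below (λ x → G y x n′) h d) c e n 1)
    (below-cong n 1 (λ n′ _ → below-comm (λ y x → G y x n′) c e h d))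

  below-1-afterD : ∀ F h n →
                   below (λ n′ → afterD F h n′) n 1 ≡ afterD (λ x n′ → below (F x) n′ 1) h n
  below-1-afterD F h zero    = refl
  below-1-afterD F h (suc n) = below-comm (λ n′ x → F x n′) n 1 h d

  walks-0-suc : ∀ h b n → walks 0 (suc h) b n ≡ below (λ y → walks 0 h y n) b 1
  walks-0-suc h zero    n = refl
  walks-0-suc h (suc b) n = refl

  below-walks-0 : ∀ b n h e → below (λ x → walks 0 x b n) h e ≡ walks 0 h (b + e) n
  below-walks-0 b n h       zero    = cong (λ y → walks 0 h y n) (sym (ℕP.+-identityʳ b))
  below-walks-0 b n zero    (suc e) = cong (λ y → walks 0 0 y n) (sym (+-suc b e))
  below-walks-0 b n (suc h) (suc e) =
    trans (below-walks-0 b n h e) (cong (λ y → walks 0 (suc h) y n) (sym (+-suc b e)))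

  walks-last-step : ∀ L h b n →
    walks (suc L) h b n ≡ below (λ y → walks L h y n) b 1 + below (λ n′ → walks L h (b + d) n′) n 1
  walks-last-step zero h b n = cong₂ _+_ (walks-0-suc h b n) (last-step-D n)
    where
    last-step-D : ∀ n → afterD (λ x n′ → walks 0 x b n′) h n ≡ below (λ n′ → walks 0 h (b + d) n′) n 1
    last-step-D zero    = refl
    last-step-D (suc n) = below-walks-0 b n h d
  walks-last-step (suc L) h b n = begin
    walks (suc L) (suc h) b n + afterD (λ x → walks (suc L) x b) h n
      ≡⟨ cong₂ _+_ (walks-last-step L (suc h) b n) (afterD-cong h n (λ x n′ _ _ → walks-last-step L x b n′)) ⟩
    (lastU (suc h) n + lastD (suc h) n) + afterD (λ x n′ → lastU x n′ + lastD x n′) h n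
      ≡⟨ cong (lastU (suc h) n + lastD (suc h) n ℕ.+_) (afterD-+-distrib lastU lastD h n) ⟩
    (lastU (suc h) n + lastD (suc h) n) + (afterD lastU h n + afterD lastD h n)
      ≡⟨ +-interchange (lastU (suc h) n) (lastD (suc h) n) _ _ ⟩
    (lastU (suc h) n + afterD lastU h n) + (lastD (suc h) n + afterD lastD h n)
      ≡⟨ cong₂ _+_ (cong (lastU (suc h) n ℕ.+_) (below-afterD (λ y x n′ → walks L x y n′) b 1 h n))
                   (cong (lastD (suc h) n ℕ.+_) (below-1-afterD (λ x n′ → walks L x (b + d) n′) h n)) ⟨
    (lastU (suc h) n + below (λ y → afterD (λ x → walks L x y) h n) b 1) +
      (lastD (suc h) n + below (λ n′ → afterD (λ x → walks L x (b + d)) h n′) n 1)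
      ≡⟨ cong₂ _+_ (below-+-distrib (λ y → walks L (suc h) y n) (λ y → afterD (λ x → walks L x y) h n) b 1)
                   (below-+-distrib (walks L (suc h) (b + d)) (afterD (λ x → walks L x (b + d)) h) n 1) ⟨
    below (λ y → walks (suc L) h y n) b 1 + below (λ n′ → walks (suc L) h (b + d) n′) n 1
      ∎
    where
    open ≡-Reasoning
    lastU lastD : ℕ → ℕ → ℕ
    lastU x n′ = below (λ y → walks L x y n′) b 1
    lastD x n′ = below (λ n″ → walks L x (b + d) n″) n′ 1

  paths-0-0-0 : paths 0 0 0 ≡ 1
  paths-0-0-0 = paths-length-zero 0 0 0 (ℕP.≤-reflexive k*0)

  paths-0-last-U : ∀ b n → paths 0 (suc b) n ≡ paths 0 b n + below (paths 0 (suc b + d)) n 1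
  paths-0-last-U b n = begin
    walks (k * n + suc b) 0 (suc b) n
      ≡⟨ cong (λ L → walks L 0 (suc b) n) (+-suc (k * n) b) ⟩
    walks (suc (k * n + b)) 0 (suc b) n
      ≡⟨ walks-last-step (k * n + b) 0 (suc b) n ⟩
    walks (k * n + b) 0 b n + below (λ n′ → walks (k * n + b) 0 (suc b + d) n′) n 1
      ≡⟨ cong (paths 0 b n ℕ.+_) (below-cong n 1 (λ n′ eq → walks-paths _ 0 _ n′ (length-eq n′ eq))) ⟩
    paths 0 b n + below (paths 0 (suc b + d)) n 1
      ∎
    where
    open ≡-Reasoning
    arith : ∀ j n b → suc (suc j) * (n + 1) + b + 0 ≡ suc (suc j) * n + (suc b + suc j)
    arith = solve-∀
    length-eq : ∀ n′ → n′ + 1 ≡ n → k * n + b + 0 ≡ k * n′ + (suc b + d)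
    length-eq n′ refl = arith j n′ b

  paths-0-last-D : ∀ n → paths 0 0 (suc n) ≡ paths 0 d n
  paths-0-last-D n = begin
    walks (k * suc n + 0) 0 0 (suc n)
      ≡⟨ cong (λ L → walks L 0 0 (suc n)) (k*suc n 0) ⟩
    walks (suc (k * n + 0 + d)) 0 0 (suc n)
      ≡⟨ walks-last-step (k * n + 0 + d) 0 0 (suc n) ⟩
    walks (k * n + 0 + d) 0 d n
      ≡⟨ walks-paths _ 0 d n (trans (ℕP.+-identityʳ _) (cong (_+ d) (ℕP.+-identityʳ _))) ⟩
    paths 0 d n
      ∎
    where open ≡-Reasoning

  ballot : ∀ n b → paths 0 b n + d * below ((k * n + b) C_) n 1 ≡ (k * n + b) C n
  ballot zero    zero    =
    trans (cong (paths 0 0 0 ℕ.+_) (ℕP.*-zeroʳ d)) (trans (ℕP.+-identityʳ _) paths-0-0-0)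
  ballot zero    (suc b) =
    trans (cong (_+ d * 0) (trans (paths-0-last-U b 0) (ℕP.+-identityʳ _))) (ballot zero b)
  ballot (suc n) zero    = begin
    paths 0 0 (suc n) + d * ((k * suc n + 0) C n)
      ≡⟨ cong₂ (λ x y → x + d * (y C n)) (paths-0-last-D n) M+1 ⟩
    paths 0 d n + d * (suc M C n)
      ≡⟨ cong (λ x → paths 0 d n + d * x) (pascal-below M n) ⟩
    paths 0 d n + d * (below (M C_) n 1 + M C n)
      ≡⟨ cong (paths 0 d n ℕ.+_) (ℕP.*-distribˡ-+ d (below (M C_) n 1) _) ⟩
    paths 0 d n + (d * below (M C_) n 1 + d * (M C n))
      ≡⟨ ℕP.+-assoc (paths 0 d n) _ _ ⟨
    paths 0 d n + d * below (M C_) n 1 + d * (M C n)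
      ≡⟨ cong₂ _+_ (ballot n d) (sym (C-ratio M n d (arith j n))) ⟩
    M C n + M C suc n
      ≡⟨ nCk+nC[k+1]≡[n+1]C[k+1] M n ⟩
    suc M C suc n
      ≡⟨ cong (_C suc n) M+1 ⟨
    (k * suc n + 0) C suc n
      ∎
    where
    open ≡-Reasoning
    M = k * n + d
    M+1 : k * suc n + 0 ≡ suc M
    M+1 = trans (k*suc n 0) (cong (λ x → suc (x + d)) (ℕP.+-identityʳ (k * n)))
    arith : ∀ j n → suc (suc (suc j) * n + suc j) ≡ suc n * suc (suc j)
    arith = solve-∀
  ballot (suc n) (suc b) = begin
    paths 0 (suc b) (suc n) + d * ((k * suc n + suc b) C n)
      ≡⟨ cong₂ (λ x y → x + d * (y C n)) (paths-0-last-U b (suc n)) (+-suc (k * suc n) b) ⟩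
    (paths 0 b (suc n) + paths 0 (suc b + d) n) + d * (suc N C n)
      ≡⟨ cong (λ x → (paths 0 b (suc n) + paths 0 (suc b + d) n) + d * x) (pascal-below N n) ⟩
    (paths 0 b (suc n) + paths 0 (suc b + d) n) + d * (below (N C_) n 1 + N C n)
      ≡⟨ regroup (paths 0 b (suc n)) _ d _ _ ⟩
    (paths 0 b (suc n) + d * (N C n)) + (paths 0 (suc b + d) n + d * below (N C_) n 1)
      ≡⟨ cong₂ _+_ (ballot (suc n) b) (trans (cong (λ X → paths 0 (suc b + d) n + d * below (X C_) n 1) N≡)
                                             (trans (ballot n (suc b + d)) (cong (_C n) (sym N≡)))) ⟩
    N C suc n + N C n
      ≡⟨ ℕP.+-comm (N C suc n) _ ⟩
    N C n + N C suc n
      ≡⟨ nCk+nC[k+1]≡[n+1]C[k+1] N n ⟩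
    suc N C suc n
      ≡⟨ cong (_C suc n) (+-suc (k * suc n) b) ⟨
    (k * suc n + suc b) C suc n
      ∎
    where
    open ≡-Reasoning
    N = k * suc n + b
    arith : ∀ j n b → suc (suc j) * suc n + b ≡ suc (suc j) * n + (suc b + suc j)
    arith = solve-∀
    N≡ : N ≡ k * n + (suc b + d)
    N≡ = arith j n b
    regroup : ∀ a b d x y → (a + b) + d * (x + y) ≡ (a + d * y) + (b + d * x)
    regroup = solve-∀

  Ck-paths : ∀ n → Ck k n ≡ paths 0 0 n
  Ck-paths n = trans (cong (_/ suc (k * n)) (C≡ n)) (m*n/n≡m (paths 0 0 n) (suc (k * n)))
    where
    C≡ : ∀ n → (k * n + 1) C n ≡ paths 0 0 n * suc (k * n)
    C≡ zero    = sym (cong₂ _*_ paths-0-0-0 (cong suc (ℕP.*-zeroʳ k)))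
    C≡ (suc m) = begin
      (k * suc m + 1) C suc m            ≡⟨ cong (_C suc m) N+1 ⟩
      suc N C suc m                      ≡⟨ fuss-catalan-from-ballot m d q N (arith j m) (ballot (suc m) 0) ⟩
      q * suc N                          ≡⟨ cong (q *_) N+1 ⟨
      q * (k * suc m + 1)                ≡⟨ cong (q *_) (ℕP.+-comm _ 1) ⟩
      q * suc (k * suc m)                ∎
      where
      open ≡-Reasoning
      N = k * suc m + 0
      q = paths 0 0 (suc m)
      N+1 : k * suc m + 1 ≡ suc N
      N+1 = trans (ℕP.+-comm _ 1) (cong suc (sym (ℕP.+-identityʳ _)))
      arith : ∀ j m → suc (suc j) * suc m + 0 ≡ suc m * suc (suc j)
      arith = solve-∀

  Ck-power-paths : ∀ b n → (Ck k ^S suc b) n ≡ paths 0 b n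
  Ck-power-paths zero    n = trans (⋆-identityʳ (Ck k) n) (Ck-paths n)
  Ck-power-paths (suc b) n = begin
    (Ck k ⋆ (Ck k ^S suc b)) n           ≡⟨ ⋆-congˡ n (Ck k ^S suc b) (λ i _ → Ck-paths i) ⟩
    (paths 0 0 ⋆ (Ck k ^S suc b)) n      ≡⟨ ⋆-congʳ n (paths 0 0) (λ i _ → Ck-power-paths b i) ⟩
    (paths 0 0 ⋆ paths 0 b) n            ≡⟨ ℕP.+-identityʳ _ ⟨
    (paths 0 0 ⋆ paths 0 b) n + 0        ≡⟨ paths-convolution 0 b n ⟨
    paths 0 (suc b) n                    ∎
    where open ≡-Reasoning

  Cnum-paths : ∀ a b n → Cnum k a b n ≡ paths a b n
  Cnum-paths a b n with a ℕ.≤? k * n + b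
  ... | yes a≤ = begin
    Cnum k a b n
      ≡⟨ Cnum-count k a b n ⟩
    count L (⌊_⌋ ∘ inD? k n a b)
      ≡⟨ count-⇔ L (inD? k n a b) (walk? k (+ a) b n) (λ p len → mk⇔ proj₂ (length-ok p len ,_)) ⟩
    count L (⌊_⌋ ∘ walk? k (+ a) b n)
      ≡⟨ count-walk L a b n ⟩
    paths a b n
      ∎
    where
    open ≡-Reasoning
    L = (k * n + b) ∸ a
    length-ok : ∀ p → length p ≡ L → + length p ≡ (+ (k * n) ℤ.+ + b) ℤ.- + a
    length-ok p len = trans (cong +_ len) (trans (sym (ℤP.⊖-≥ a≤)) (sym (ℤP.m-n≡m⊖n (k * n + b) a)))
  ... | no a≰ = trans (Cnum-count k a b n)
    (trans (count-⊥ ((k * n + b) ∸ a) (inD? k n a b)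
                    (λ p _ (l , _) → a≰ (⊖-nonneg⇒≤ (k * n + b) a (trans l (ℤP.m-n≡m⊖n (k * n + b) a)))))
           (sym (paths-vanish a b n (ℕP.≰⇒> a≰))))

  mCnum-0-⋆ : ∀ a b n → mCnum k a b 0 n ≡ (Cnum k a 0 ⋆ (Ck k ^S b)) n
  mCnum-0-⋆ a zero    n = trans (mCnum-end-0 k a n) (sym (⋆-identityʳ (Cnum k a 0) n))
  mCnum-0-⋆ a (suc b) n = ℕP.+-cancelʳ-≡ (below (λ x → Cnum k x b n) a 1) _ _ (begin
    mCnum k a (suc b) 0 n + below (λ x → Cnum k x b n) a 1
      ≡⟨ Cnum-min-split k a b n ⟨
    Cnum k a (suc b) n
      ≡⟨ Cnum-paths a (suc b) n ⟩
    paths a (suc b) n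
      ≡⟨ paths-convolution a b n ⟩
    (paths a 0 ⋆ paths 0 b) n + below (λ x → paths x b n) a 1
      ≡⟨ cong₂ _+_ first-passage (below-cong a 1 (λ x _ → sym (Cnum-paths x b n))) ⟩
    (Cnum k a 0 ⋆ (Ck k ^S suc b)) n + below (λ x → Cnum k x b n) a 1
      ∎)
    where
    open ≡-Reasoning
    first-passage : (paths a 0 ⋆ paths 0 b) n ≡ (Cnum k a 0 ⋆ (Ck k ^S suc b)) n
    first-passage = trans (⋆-congˡ n (paths 0 b) (λ i _ → sym (Cnum-paths a 0 i)))
                          (⋆-congʳ n (Cnum k a 0) (λ i _ → sym (Ck-power-paths b i)))

theorem3p2 : (k : ℕ) → 2 ≤ k → (α β m : ℕ) → m ≤ α → m ≤ β →
    (n : ℕ) → mCGF k α β m n ≡ (CGF k (α ∸ m) 0 ⋆ (Ck k ^S (β ∸ m))) n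
theorem3p2 (suc zero)    (s≤s ()) _ _ _ _ _ _
theorem3p2 (suc (suc j)) _ α β m m≤α m≤β n = begin
  mCnum k α β m n
    ≡⟨ cong₂ (λ x y → mCnum k x y m n) (ℕP.m+[n∸m]≡n m≤α) (ℕP.m+[n∸m]≡n m≤β) ⟨
  mCnum k (m + (α ∸ m)) (m + (β ∸ m)) m n
    ≡⟨ mCnum-shift k m (α ∸ m) (β ∸ m) n ⟩
  mCnum k (α ∸ m) (β ∸ m) 0 n
    ≡⟨ Walks.mCnum-0-⋆ j (α ∸ m) (β ∸ m) n ⟩
  (Cnum k (α ∸ m) 0 ⋆ (Ck k ^S (β ∸ m))) n
    ∎
  where
  open ≡-Reasoning
  k = suc (suc j)
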